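{- For all positive integers $n$ and $k$ such that $n \geq k+1$, we have $B_k(P_n)=k+1$.
   Context: $P_n$ is the path on $n$ vertices $v_1,\dots,v_n$ (in order along the path), with the graph distance $\mathrm{dist}(v_i,v_j)=|i-j|$; the set of positive distances realized is $\{1,2,\dots,n-1\}$. For a set $D$ of positive integers, the distance graph $G(P_n,D)$ has vertex set $\{v_1,\dots,v_n\}$, with $v_i,v_j$ ($i\neq j$) adjacent iff $|i-j|\in D$; $\chi(P_n,D)$ denotes its chromatic number. The $k$-th Babai number is $B_k(P_n)=\max\{\chi(P_n,D): D\subseteq\{1,\dots,n-1\},\ |D|=k\}$ (defined for $k\le n-1$). -}

module Defs where

open import Data.Nat using (ℕ; _≤_; _<_; ∣_-_∣)
open import Data.Fin using (Fin; toℕ)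
open import Data.List using (List; length)
open import Data.List.Membership.Propositional using (_∈_)
open import Data.List.Relation.Unary.All using (All)
open import Data.List.Relation.Unary.Unique.Propositional using (Unique)
open import Data.Product using (Σ; _×_; ∃)
open import Relation.Binary.PropositionalEquality using (_≡_; _≢_)

ValidDistSet : ℕ → List ℕ → Set
ValidDistSet n D = Unique D × All (λ d → 0 < d × d < n) D

-- Vertices of P_n are Fin n (v_{i+1} ↦ i); dist(v_i,v_j) = ∣ i - j ∣.
-- Adjacency in the distance graph G(P_n, D).
Adjacent : (n : ℕ) → List ℕ → Fin n → Fin n → Set
Adjacent n D i j = (i ≢ j) × (∣ toℕ i - toℕ j ∣ ∈ D)

ProperColoring : (n : ℕ) → List ℕ → (m : ℕ) → (Fin n → Fin m) → Set
ProperColoring n D m c = ∀ i j → Adjacent n D i j → c i ≢ c j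

Colorable : ℕ → List ℕ → ℕ → Set
Colorable n D m = Σ (Fin n → Fin m) (ProperColoring n D m)

IsChromaticNumber : ℕ → List ℕ → ℕ → Set
IsChromaticNumber n D m = Colorable n D m × (∀ m' → Colorable n D m' → m ≤ m')

IsBabaiNumber : ℕ → ℕ → ℕ → Set
IsBabaiNumber n k b =
  (∃ λ D → ValidDistSet n D × length D ≡ k × IsChromaticNumber n D b)
  × (∀ D → ValidDistSet n D → length D ≡ k → ∀ m → IsChromaticNumber n D m → m ≤ b)

-- Greedy colouring along the path, one vertex at a time, gives every vertex at most |D|
-- already coloured neighbours, so χ(P_n, D) ≤ |D| + 1 for every D. For D = {1, …, k} the
-- first k + 1 vertices are pairwise adjacent, so this bound is attained.
module Submission where

open import Defs
open import Data.Nat using (ℕ; zero; suc; _+_; _≤_; _<_; _<?_; ∣_-_∣; z≤n; s≤s)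
open import Data.Nat.Properties
  using (+-comm; ≤-reflexive; ≤-trans; <-≤-trans; ≤-<-trans; ≤-pred; ⊔-lub; ∣m-n∣≤m⊔n; ∣m-n∣≡0⇒m≡n; n≢0⇒n>0; suc-injective; <⇒≢)
open import Data.Fin using (Fin; zero; suc; toℕ; fromℕ<; inject≤)
open import Data.Fin.Properties using (_≟_; toℕ<n; fromℕ<-toℕ; toℕ-inject≤; inject≤-injective; toℕ-injective; ¬∀⟶∃¬; injective⇒≤)
open import Data.List using (List; map; length; lookup; applyDownFrom)
open import Data.List.Properties using (length-map; length-applyDownFrom)
open import Data.List.Membership.Propositional using (_∈_; _∉_)
open import Data.List.Membership.Propositional.Properties using (∈-map⁺)
import Data.List.Membership.DecPropositional as DecMembership
import Data.List.Relation.Unary.Any as Any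
open import Data.List.Relation.Unary.Any.Properties using (lookup-index; applyDownFrom⁺)
open import Data.List.Relation.Unary.All.Properties using (applyDownFrom⁺₁)
open import Data.List.Relation.Unary.Unique.Propositional.Properties using () renaming (applyDownFrom⁺₁ to Unique-applyDownFrom⁺₁)
open import Data.Product using (_,_; ∃; proj₁; proj₂)
open import Relation.Nullary using (yes; no; contradiction)
open import Relation.Binary.PropositionalEquality using (_≡_; _≢_; refl; sym; trans; cong; subst)

covering⇒≤length : ∀ {m} (xs : List (Fin m)) → (∀ x → x ∈ xs) → m ≤ length xs
covering⇒≤length xs covers = injective⇒≤ index-injective
  where
  index-injective : ∀ {x y} → Any.index (covers x) ≡ Any.index (covers y) → x ≡ y
  index-injective {x} {y} eq =
    trans (lookup-index (covers x)) (trans (cong (lookup xs) eq) (sym (lookup-index (covers y))))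

∃∉-length< : ∀ {m} (xs : List (Fin m)) → length xs < m → ∃ λ x → x ∉ xs
∃∉-length< {m} xs |xs|<m = ¬∀⟶∃¬ m (_∈ xs) (λ x → DecMembership._∈?_ (_≟_ {m}) x xs)
  (λ covers → <⇒≢ (<-≤-trans |xs|<m (covering⇒≤length xs covers)) refl)

-- The new vertex is prepended as vertex 0. Its neighbours carry the colours
-- colourAtDistance d for d ∈ D (junk values outside 1 … n), at most |D| < m colours.
colorable-suc : ∀ {n m} D → length D < m → Colorable n D m → Colorable (suc n) D m
colorable-suc {n} {suc m} D |D|<m (c , proper) = c′ , proper′
  where
  colourAtDistance : ℕ → Fin (suc m)
  colourAtDistance (suc d) with d <? n
  ... | yes d<n = c (fromℕ< d<n)
  ... | no _    = zero
  colourAtDistance zero = zero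

  colourAtDistance-suc : ∀ j → colourAtDistance (suc (toℕ j)) ≡ c j
  colourAtDistance-suc j with toℕ j <? n
  ... | yes j<n = cong c (fromℕ<-toℕ j j<n)
  ... | no  j≮n = contradiction (toℕ<n j) j≮n

  free : ∃ λ x → x ∉ map colourAtDistance D
  free = ∃∉-length< (map colourAtDistance D) (subst (_< suc m) (sym (length-map colourAtDistance D)) |D|<m)

  free-avoids : ∀ j → suc (toℕ j) ∈ D → proj₁ free ≢ c j
  free-avoids j j+1∈D eq = proj₂ free
    (subst (_∈ map colourAtDistance D) (trans (colourAtDistance-suc j) (sym eq)) (∈-map⁺ colourAtDistance j+1∈D))

  c′ : Fin (suc n) → Fin (suc m)
  c′ zero    = proj₁ free
  c′ (suc i) = c i

  proper′ : ProperColoring (suc n) D (suc m) c′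
  proper′ zero    zero    (i≢j , _) = contradiction refl i≢j
  proper′ zero    (suc j) (_ , d∈D) = free-avoids j d∈D
  proper′ (suc i) zero    (_ , d∈D) = λ eq → free-avoids i d∈D (sym eq)
  proper′ (suc i) (suc j) (i≢j , d∈D) = proper i j ((λ eq → i≢j (cong suc eq)) , d∈D)

colorable-length< : ∀ n D {m} → length D < m → Colorable n D m
colorable-length< zero    D |D|<m = (λ ()) , λ ()
colorable-length< (suc n) D |D|<m = colorable-suc D |D|<m (colorable-length< n D |D|<m)

distancesUpTo : ℕ → List ℕ
distancesUpTo = applyDownFrom suc

∈-distancesUpTo : ∀ {k d} → 0 < d → d ≤ k → d ∈ distancesUpTo k
∈-distancesUpTo {d = suc d} _ d<k = applyDownFrom⁺ suc refl d<k

distancesUpTo-valid : ∀ {n k} → k < n → ValidDistSet n (distancesUpTo k)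
distancesUpTo-valid {k = k} k<n =
  Unique-applyDownFrom⁺₁ suc k (λ j<i _ eq → <⇒≢ j<i (sym (suc-injective eq))) ,
  applyDownFrom⁺₁ suc k (λ i<k → s≤s z≤n , ≤-<-trans i<k k<n)

∣-∣-≤ : ∀ {a b k} → a ≤ k → b ≤ k → ∣ a - b ∣ ≤ k
∣-∣-≤ {a} {b} a≤k b≤k = ≤-trans (∣m-n∣≤m⊔n a b) (⊔-lub a≤k b≤k)

clique⇒colours≥ : ∀ {n k m} D → (∀ {d} → 0 < d → d ≤ k → d ∈ D) → suc k ≤ n → Colorable n D m → suc k ≤ m
clique⇒colours≥ {n} {k} D [1,k]⊆D k<n (c , proper) = injective⇒≤ colour-injective
  where
  vertex : Fin (suc k) → Fin n
  vertex i = inject≤ i k<n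

  adjacent : ∀ {i j} → i ≢ j → Adjacent n D (vertex i) (vertex j)
  adjacent {i} {j} i≢j rewrite toℕ-inject≤ i k<n | toℕ-inject≤ j k<n =
    (λ eq → i≢j (inject≤-injective k<n k<n i j eq)) ,
    [1,k]⊆D (n≢0⇒n>0 (λ eq → i≢j (toℕ-injective (∣m-n∣≡0⇒m≡n eq))))
            (∣-∣-≤ (≤-pred (toℕ<n i)) (≤-pred (toℕ<n j)))

  colour-injective : ∀ {i j} → c (vertex i) ≡ c (vertex j) → i ≡ j
  colour-injective {i} {j} eq with i ≟ j
  ... | yes i≡j = i≡j
  ... | no  i≢j = contradiction eq (proper (vertex i) (vertex j) (adjacent i≢j))

theorem2p1 : (n k : ℕ) → 1 ≤ k → k + 1 ≤ n → IsBabaiNumber n k (k + 1)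
theorem2p1 n k _ k<n rewrite +-comm k 1 =
  (D , distancesUpTo-valid k<n , length-applyDownFrom suc k , colorable , minimal) ,
  λ D′ _ |D′|≡k m (_ , m-minimal) → m-minimal (suc k) (colorable-length< n D′ (s≤s (≤-reflexive |D′|≡k)))
  where
  D = distancesUpTo k
  colorable : Colorable n D (suc k)
  colorable = colorable-length< n D (s≤s (≤-reflexive (length-applyDownFrom suc k)))
  minimal : ∀ m → Colorable n D m → suc k ≤ m
  minimal _ = clique⇒colours≥ D ∈-distancesUpTo k<n
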